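{- Let $G$ be a counterexample with the fewest number of vertices to the statement "every graph $G$ with $\mathrm{mad}(G)<\frac52$, $g(G)\geq 10$ and $\Delta(G)=4$ satisfies $\chi^2_l(G)\leq 6$". Then every endvertex of a $2$-path in $G$ is a $4$-vertex.
   Context: Graphs are finite and simple. $\mathrm{mad}(G)$ is the maximum of $2|E(H)|/|V(H)|$ over subgraphs $H$ of $G$; $g(G)$ is the girth; $\Delta(G)$ the maximum degree. $\chi^2_l(G)$ is the smallest $k$ such that for every assignment of lists of size at least $k$ to the vertices there is a choice of colors from the lists with vertices at distance at most $2$ receiving different colors. A $d$-vertex ($d^+$-vertex) is a vertex of degree $d$ (at least $d$). A $k$-path is a path of length $k+1$ whose $k$ internal vertices are $2$-vertices and whose two endvertices are $3^+$-vertices. -}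

module Defs where

open import Data.Nat using (ℕ; zero; suc; _+_; _*_; _≤_; _<_)
open import Data.Fin using (Fin; zero; suc; toℕ; fromℕ)
open import Data.Bool using (Bool; true; false; if_then_else_)
open import Data.List using (List; length)
open import Data.List.Membership.Propositional using (_∈_)
open import Data.List.Relation.Unary.Unique.Propositional using (Unique)
open import Data.Product using (Σ; ∃; ∃-syntax; _×_; _,_; proj₁)
open import Data.Empty using (⊥)
open import Data.Sum using (_⊎_)
open import Relation.Binary.PropositionalEquality using (_≡_; _≢_)
open import Relation.Nullary using (¬_)
open import Function.Definitions using (Injective)

sumFin : (n : ℕ) → (Fin n → ℕ) → ℕ
sumFin zero    f = 0
sumFin (suc n) f = f zero + sumFin n (λ i → f (suc i))

ind : Bool → ℕ
ind b = if b then 1 else 0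

record Graph : Set where
  field
    n      : ℕ
    adj    : Fin n → Fin n → Bool
    adj-sym    : ∀ u v → adj u v ≡ adj v u
    adj-irrefl : ∀ v → adj v v ≡ false

open Graph public

Adj : (G : Graph) → Fin (n G) → Fin (n G) → Set
Adj G u v = adj G u v ≡ true

deg : (G : Graph) → Fin (n G) → ℕ
deg G v = sumFin (n G) (λ u → ind (adj G v u))

MaxDegreeIs : Graph → ℕ → Set
MaxDegreeIs G d = (∀ v → deg G v ≤ d) × (∃[ v ] deg G v ≡ d)

record Subgraph (G : Graph) : Set where
  field
    S      : Fin (n G) → Bool
    F      : Fin (n G) → Fin (n G) → Bool
    F-sym  : ∀ u v → F u v ≡ F v u
    F-sub  : ∀ u v → F u v ≡ true → Adj G u v × S u ≡ true × S v ≡ true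

vcount : {G : Graph} → Subgraph G → ℕ
vcount {G} H = sumFin (n G) (λ v → ind (Subgraph.S H v))

twiceEcount : {G : Graph} → Subgraph G → ℕ
twiceEcount {G} H =
  sumFin (n G) (λ u → sumFin (n G) (λ v → ind (Subgraph.F H u v)))

-- mad(G) < 5/2 : every nonempty subgraph H has 2|E(H)|/|V(H)| < 5/2,
-- i.e. 2 * (2|E(H)|) < 5 * |V(H)|.
MadLessFiveHalves : Graph → Set
MadLessFiveHalves G =
  (H : Subgraph G) → 0 < vcount H → 2 * twiceEcount H < 5 * vcount H

-- A cycle of length (suc m) ≥ 3: injective f : Fin (suc m) → V(G) with
-- consecutive vertices adjacent and the last adjacent to the first.
Cycle : (G : Graph) → ℕ → Set
Cycle G zero    = ⊥
Cycle G (suc m) =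
  (2 ≤ m) ×
  Σ (Fin (suc m) → Fin (n G)) λ f →
    Injective _≡_ _≡_ f ×
    (∀ (i j : Fin (suc m)) → toℕ j ≡ suc (toℕ i) → Adj G (f i) (f j)) ×
    Adj G (f (fromℕ m)) (f zero)

-- g(G) ≥ k : no cycle of length < k (acyclic graphs have infinite girth)
GirthAtLeast : Graph → ℕ → Set
GirthAtLeast G k = ∀ l → l < k → ¬ Cycle G l

Dist≤2 : (G : Graph) → Fin (n G) → Fin (n G) → Set
Dist≤2 G u v = Adj G u v ⊎ (∃[ w ] Adj G u w × Adj G w v)

ListAssignment : Graph → ℕ → Set
ListAssignment G k =
  Σ (Fin (n G) → List ℕ) λ L → ∀ v → Unique (L v) × k ≤ length (L v)

Is2DistListColoring : (G : Graph) → (Fin (n G) → List ℕ) → (Fin (n G) → ℕ) → Set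
Is2DistListColoring G L c =
  (∀ v → c v ∈ L v) × (∀ u v → u ≢ v → Dist≤2 G u v → c u ≢ c v)

Chi2lAtMost : Graph → ℕ → Set
Chi2lAtMost G k =
  (A : ListAssignment G k) →
  Σ (Fin (n G) → ℕ) λ c → Is2DistListColoring G (proj₁ A) c

Hyp : Graph → Set
Hyp G = MadLessFiveHalves G × GirthAtLeast G 10 × MaxDegreeIs G 4

MinimalCounterexample : Graph → Set
MinimalCounterexample G =
  Hyp G × ¬ Chi2lAtMost G 6 ×
  (∀ (H : Graph) → n H < n G → Hyp H → Chi2lAtMost H 6)

TwoPath : (G : Graph) → (x a b y : Fin (n G)) → Set
TwoPath G x a b y =
  3 ≤ deg G x × 3 ≤ deg G y × deg G a ≡ 2 × deg G b ≡ 2 ×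
  Adj G x a × Adj G a b × Adj G b y × x ≢ y

module Submission where

-- If the end x of the 2-path x a b y were a 3-vertex, delete a. The graph G ∖ a still
-- satisfies the hypotheses (no 4-vertex of G is a neighbour of a), so by minimality it has
-- a 2-distance colouring from the lists. The only new pair at distance two is {x, b}; if it
-- clashes, b is recoloured, seeing at most the 5 colours of y and N(y) (b's own colour among
-- them). Then a sees at most the 5 colours of N(x), b and y, so G is colourable after all.

open import Defs
open import Data.Bool using (Bool; true; false)
open import Data.Empty using (⊥-elim)
open import Data.Fin using (Fin; zero; suc; punchIn; punchOut; _≟_)
open import Data.Fin.Properties using (punchIn-injective; punchIn-punchOut)
open import Data.List using (List; []; _∷_; length; map)
open import Data.List.Properties using (length-map; length-removeAt′)
open import Data.List.Membership.Propositional using (_∈_; _∉_; _─_)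
open import Data.List.Membership.Propositional.Properties using (∈-map⁺)
open import Data.List.Relation.Unary.Any using (here; there)
import Data.List.Relation.Unary.All as All
open import Data.List.Relation.Unary.Unique.Propositional using (Unique; _∷_)
import Data.Nat as ℕ
open import Data.Nat using (ℕ; zero; suc; pred; _+_; _*_; _≤_; _<_; s≤s)
open import Data.Nat.Properties using (n<1+n; <-irrefl; ≤-antisym; ≤∧≢⇒<; ≤-pred; ≤-reflexive; ≤-trans; m≤m+n; m≤n+m; +-monoʳ-≤; +-commutativeSemigroup)
open import Algebra.Properties.CommutativeSemigroup +-commutativeSemigroup using (x∙yz≈y∙xz)
open import Data.Product using (∃-syntax; _×_; _,_; proj₁; proj₂)
open import Data.Sum using (_⊎_; inj₁; inj₂)
open import Data.Vec.Functional using (insertAt; updateAt)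
open import Data.Vec.Functional.Properties using (insertAt-lookup; insertAt-punchIn; updateAt-updates; updateAt-minimal)
open import Function using (_∘_)
open import Relation.Binary.Definitions using (DecidableEquality; Symmetric)
open import Relation.Binary.PropositionalEquality
open import Relation.Nullary using (¬_; yes; no)
open import Data.Bool.Properties using (¬-not)

sumFin-cong : ∀ k {f g : Fin k → ℕ} → (∀ i → f i ≡ g i) → sumFin k f ≡ sumFin k g
sumFin-cong zero    f≗g = refl
sumFin-cong (suc k) f≗g = cong₂ _+_ (f≗g zero) (sumFin-cong k (f≗g ∘ suc))

sumFin-zero : ∀ k {f : Fin k → ℕ} → (∀ i → f i ≡ 0) → sumFin k f ≡ 0
sumFin-zero zero    f≗0 = refl
sumFin-zero (suc k) f≗0 rewrite f≗0 zero = sumFin-zero k (f≗0 ∘ suc)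

skip : ∀ {k} → Fin k → Fin (pred k) → Fin k
skip {suc _} = punchIn

skip-injective : ∀ {k} (a : Fin k) {i j} → skip a i ≡ skip a j → i ≡ j
skip-injective {suc _} a = punchIn-injective a _ _

unskip : ∀ {k} {a v : Fin k} → a ≢ v → Fin (pred k)
unskip {suc _} = punchOut

skip-unskip : ∀ {k} {a v : Fin k} (a≢v : a ≢ v) → skip a (unskip a≢v) ≡ v
skip-unskip {suc _} = punchIn-punchOut

data SkipView {k} (a : Fin k) : Fin k → Set where
  self    : SkipView a a
  skipped : ∀ i → SkipView a (skip a i)

skipView : ∀ {k} (a v : Fin k) → SkipView a v
skipView a v with a ≟ v
... | yes refl = self
... | no a≢v   = subst (SkipView a) (skip-unskip a≢v) (skipped (unskip a≢v))

insert : ∀ {k} {A : Set} → Fin k → A → (Fin (pred k) → A) → Fin k → A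
insert {suc _} a d f = insertAt f a d

insert-self : ∀ {k} {A : Set} (a : Fin k) (d : A) f → insert a d f a ≡ d
insert-self {suc _} a d f = insertAt-lookup f a d

insert-skip : ∀ {k} {A : Set} (a : Fin k) (d : A) f i → insert a d f (skip a i) ≡ f i
insert-skip {suc _} a d f i = insertAt-punchIn f a d i

sumFin-skip : ∀ {k} (a : Fin k) (f : Fin k → ℕ) →
              sumFin k f ≡ f a + sumFin (pred k) (f ∘ skip a)
sumFin-skip {suc _}       zero    f = refl
sumFin-skip {suc (suc _)} (suc a) f =
  trans (cong (f zero +_) (sumFin-skip a (f ∘ suc))) (x∙yz≈y∙xz (f zero) (f (suc a)) _)

≤-sumFin : ∀ {k} (f : Fin k → ℕ) i → f i ≤ sumFin k f
≤-sumFin f i rewrite sumFin-skip i f = m≤m+n (f i) _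

+-≤-sumFin : ∀ {k} (f : Fin k → ℕ) {i j} → i ≢ j → f i + f j ≤ sumFin k f
+-≤-sumFin f {i} {j} i≢j with skipView i j
... | self      = ⊥-elim (i≢j refl)
... | skipped j′ rewrite sumFin-skip i f = +-monoʳ-≤ (f i) (≤-sumFin (f ∘ skip i) j′)

+-+-≤-sumFin : ∀ {k} (f : Fin k → ℕ) {i j l} → i ≢ j → i ≢ l → j ≢ l →
               f i + (f j + f l) ≤ sumFin k f
+-+-≤-sumFin f {i} {j} {l} i≢j i≢l j≢l with skipView i j | skipView i l
... | self       | _          = ⊥-elim (i≢j refl)
... | _          | self       = ⊥-elim (i≢l refl)
... | skipped j′ | skipped l′ rewrite sumFin-skip i f =
  +-monoʳ-≤ (f i) (+-≤-sumFin (f ∘ skip i) (j≢l ∘ cong (skip i)))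

trueIndices : ∀ {k} → (Fin k → Bool) → List (Fin k)
trueIndices {zero}  p = []
trueIndices {suc k} p with p zero
... | true  = zero ∷ map suc (trueIndices (p ∘ suc))
... | false = map suc (trueIndices (p ∘ suc))

length-trueIndices : ∀ {k} (p : Fin k → Bool) → length (trueIndices p) ≡ sumFin k (ind ∘ p)
length-trueIndices {zero}  p = refl
length-trueIndices {suc k} p with p zero
... | true  = cong suc (trans (length-map suc (trueIndices (p ∘ suc))) (length-trueIndices (p ∘ suc)))
... | false = trans (length-map suc (trueIndices (p ∘ suc))) (length-trueIndices (p ∘ suc))

∈-trueIndices : ∀ {k} (p : Fin k → Bool) {i} → p i ≡ true → i ∈ trueIndices p
∈-trueIndices {suc k} p {i} pi with p zero in p0 | i
... | true  | zero  = here refl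
... | true  | suc i = there (∈-map⁺ suc (∈-trueIndices (p ∘ suc) pi))
... | false | zero  with () ← trans (sym p0) pi
... | false | suc i = ∈-map⁺ suc (∈-trueIndices (p ∘ suc) pi)

module _ (G : Graph) where

  Adj-sym : ∀ {u v} → Adj G u v → Adj G v u
  Adj-sym {u} {v} = trans (adj-sym G v u)

  Dist≤2-sym : ∀ {u v} → Dist≤2 G u v → Dist≤2 G v u
  Dist≤2-sym (inj₁ uv)            = inj₁ (Adj-sym uv)
  Dist≤2-sym (inj₂ (w , uw , wv)) = inj₂ (w , Adj-sym wv , Adj-sym uw)

  Adj⇒≢ : ∀ {u v} → Adj G u v → u ≢ v
  Adj⇒≢ {u} uv refl with () ← trans (sym uv) (adj-irrefl G u)

  2-vertex≢3⁺-vertex : ∀ {u v} → deg G u ≡ 2 → 3 ≤ deg G v → u ≢ v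
  2-vertex≢3⁺-vertex u-2 v-3⁺ refl = <-irrefl refl (subst (3 ≤_) u-2 v-3⁺)

  neighbours : Fin (n G) → List (Fin (n G))
  neighbours v = trueIndices (adj G v)

  ∈-neighbours : ∀ {v w} → Adj G v w → w ∈ neighbours v
  ∈-neighbours = ∈-trueIndices (adj G _)

  length-colours : (c : Fin (n G) → ℕ) (v : Fin (n G)) → length (map c (neighbours v)) ≡ deg G v
  length-colours c v = trans (length-map c (neighbours v)) (length-trueIndices (adj G v))

  degree-two-neighbours : ∀ {v p q w} → deg G v ≡ 2 → Adj G v p → Adj G v q → p ≢ q →
                          Adj G v w → w ≡ p ⊎ w ≡ q
  degree-two-neighbours {v} {p} {q} {w} v-2 vp vq p≢q vw with w ≟ p | w ≟ q
  ... | yes w≡p | _       = inj₁ w≡p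
  ... | no _    | yes w≡q = inj₂ w≡q
  ... | no w≢p  | no w≢q
    with +-+-≤-sumFin (ind ∘ adj G v) p≢q (w≢p ∘ sym) (w≢q ∘ sym)
  ... | three≤deg rewrite vp | vq | vw | v-2 = ⊥-elim (<-irrefl refl three≤deg)

∈-─ : ∀ {A : Set} {xs : List A} {w z} (z∈xs : z ∈ xs) → w ∈ xs → w ≢ z → w ∈ xs ─ z∈xs
∈-─ (here refl)  (here w≡z)  w≢z = ⊥-elim (w≢z w≡z)
∈-─ (here refl)  (there w∈)  w≢z = w∈
∈-─ (there z∈xs) (here w≡x)  w≢z = here w≡x
∈-─ (there z∈xs) (there w∈)  w≢z = there (∈-─ z∈xs w∈ w≢z)

module _ {A : Set} (_≟ᴬ_ : DecidableEquality A) where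
  open import Data.List.Membership.DecPropositional _≟ᴬ_ using (_∈?_)

  ∃-∉ : ∀ {xs ys : List A} → Unique xs → length ys < length xs → ∃[ z ] z ∈ xs × z ∉ ys
  ∃-∉ {z ∷ xs} {ys} (z∉xs ∷ xs!) |ys|<|xs| with z ∈? ys
  ... | no z∉ys = z , here refl , z∉ys
  ... | yes z∈ys with ∃-∉ {xs} {ys ─ z∈ys} xs!
                  (≤-pred (subst (_< suc (length xs)) (length-removeAt′ ys _) |ys|<|xs|))
  ... | w , w∈xs , w∉ys─z =
    w , there w∈xs , λ w∈ys → w∉ys─z (∈-─ z∈ys w∈ys (All.lookup z∉xs w∈xs ∘ sym))

module _ {k : ℕ} where

  ProperFor : (Fin k → Fin k → Set) → (Fin k → ℕ) → Set
  ProperFor R c = ∀ u v → u ≢ v → R u v → c u ≢ c v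

  Away : Fin k → (Fin k → Fin k → Set) → Fin k → Fin k → Set
  Away p R u v = p ≢ u × p ≢ v × R u v

  Away-sym : ∀ {R} → Symmetric R → ∀ p → Symmetric (Away p R)
  Away-sym R-sym p (p≢u , p≢v , uv) = p≢v , p≢u , R-sym uv

  recolour : (c : Fin k → ℕ) → Fin k → ℕ → Fin k → ℕ
  recolour c p z = updateAt c p (λ _ → z)

  recolour-self : ∀ c p z → recolour c p z p ≡ z
  recolour-self c p z = updateAt-updates p c

  recolour-other : ∀ c {p} z {v} → p ≢ v → recolour c p z v ≡ c v
  recolour-other c {p} z {v} p≢v = updateAt-minimal v p c (p≢v ∘ sym)

  recolour-∈ : ∀ {L : Fin k → List ℕ} {c p z v} → z ∈ L p → (p ≢ v → c v ∈ L v) →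
               recolour c p z v ∈ L v
  recolour-∈ {c = c} {p} {z} {v} z∈ c-∈ with p ≟ v
  ... | yes refl = subst (_∈ _) (sym (recolour-self c p z)) z∈
  ... | no p≢v   = subst (_∈ _) (sym (recolour-other c z p≢v)) (c-∈ p≢v)

  recolour-proper : ∀ {R} → Symmetric R → ∀ {c p z F} →
                    ProperFor (Away p R) c → (∀ v → p ≢ v → R p v → c v ∈ F) → z ∉ F →
                    ProperFor R (recolour c p z)
  recolour-proper {R} R-sym {c} {p} {z} {F} c-proper forced z∉F u v u≢v uv
    with p ≟ u | p ≟ v
  ... | yes refl | yes refl = ⊥-elim (u≢v refl)
  ... | yes refl | no p≢v   =
    subst₂ _≢_ (sym (recolour-self c p z)) (sym (recolour-other c z p≢v))
      (λ z≡cv → z∉F (subst (_∈ F) (sym z≡cv) (forced v p≢v uv)))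
  ... | no p≢u   | yes refl =
    subst₂ _≢_ (sym (recolour-other c z p≢u)) (sym (recolour-self c p z))
      (λ cu≡z → z∉F (subst (_∈ F) cu≡z (forced u p≢u (R-sym uv))))
  ... | no p≢u   | no p≢v   =
    subst₂ _≢_ (sym (recolour-other c z p≢u)) (sym (recolour-other c z p≢v))
      (c-proper u v u≢v (p≢u , p≢v , uv))

  recolour-from-list : ∀ {R} → Symmetric R → ∀ (c : Fin k → ℕ) p {Lp F : List ℕ} →
    Unique Lp → length F < length Lp →
    (∀ v → p ≢ v → R p v → c v ∈ F) → ProperFor (Away p R) c →
    ∃[ z ] z ∈ Lp × ProperFor R (recolour c p z)
  recolour-from-list R-sym c p Lp! shorter-than-list forced c-proper with ∃-∉ ℕ._≟_ Lp! shorter-than-list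
  ... | z , z∈Lp , z∉F = z , z∈Lp , recolour-proper R-sym c-proper forced z∉F

_∖_ : (G : Graph) → Fin (n G) → Graph
G ∖ a = record
  { n          = pred (n G)
  ; adj        = λ i j → adj G (skip a i) (skip a j)
  ; adj-sym    = λ i j → adj-sym G (skip a i) (skip a j)
  ; adj-irrefl = λ i → adj-irrefl G (skip a i)
  }

pred<n : ∀ {k} → Fin k → pred k < k
pred<n {suc k} _ = n<1+n k

module Deletion (G : Graph) (a : Fin (n G)) where

  deg-skip : ∀ i → deg G (skip a i) ≡ ind (adj G (skip a i) a) + deg (G ∖ a) i
  deg-skip i = sumFin-skip a (ind ∘ adj G (skip a i))

  module Pushforward (K : Subgraph (G ∖ a)) where
    open Subgraph K

    S⁺ : Fin (n G) → Bool
    S⁺ = insert a false S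

    F⁺ : Fin (n G) → Fin (n G) → Bool
    F⁺ = insert a (λ _ → false) (λ i → insert a false (F i))

    F⁺-skip : ∀ i j → F⁺ (skip a i) (skip a j) ≡ F i j
    F⁺-skip i j = trans (cong-app (insert-skip a (λ _ → false) (λ i → insert a false (F i)) i) (skip a j))
                        (insert-skip a false (F i) j)

    F⁺-self : ∀ v → F⁺ a v ≡ false
    F⁺-self = cong-app (insert-self a (λ _ → false) (λ i → insert a false (F i)))

    F⁺-self′ : ∀ u → F⁺ u a ≡ false
    F⁺-self′ u with skipView a u
    ... | self      = F⁺-self a
    ... | skipped i = trans (cong-app (insert-skip a (λ _ → false) (λ i → insert a false (F i)) i) a)
                            (insert-self a false (F i))

    F⁺-sym : ∀ u v → F⁺ u v ≡ F⁺ v u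
    F⁺-sym u v with skipView a u | skipView a v
    ... | self      | _         = trans (F⁺-self v) (sym (F⁺-self′ v))
    ... | skipped i | self      = trans (F⁺-self′ (skip a i)) (sym (F⁺-self (skip a i)))
    ... | skipped i | skipped j =
      trans (F⁺-skip i j) (trans (F-sym i j) (sym (F⁺-skip j i)))

    F⁺-sub : ∀ u v → F⁺ u v ≡ true → Adj G u v × S⁺ u ≡ true × S⁺ v ≡ true
    F⁺-sub u v uv with skipView a u | skipView a v
    ... | self      | _         with () ← trans (sym (F⁺-self v)) uv
    ... | skipped i | self      with () ← trans (sym (F⁺-self′ (skip a i))) uv
    ... | skipped i | skipped j with F-sub i j (trans (sym (F⁺-skip i j)) uv)
    ...   | ij , Si , Sj =
      ij , trans (insert-skip a false S i) Si , trans (insert-skip a false S j) Sj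

    K⁺ : Subgraph G
    K⁺ = record { S = S⁺ ; F = F⁺ ; F-sym = F⁺-sym ; F-sub = F⁺-sub }

    vcount-K⁺ : vcount K⁺ ≡ vcount K
    vcount-K⁺ = begin
      sumFin (n G) (ind ∘ S⁺)                                  ≡⟨ sumFin-skip a (ind ∘ S⁺) ⟩
      ind (S⁺ a) + sumFin (pred (n G)) (ind ∘ S⁺ ∘ skip a)     ≡⟨ cong₂ _+_ (cong ind (insert-self a false S))
                                                                    (sumFin-cong _ (cong ind ∘ insert-skip a false S)) ⟩
      sumFin (pred (n G)) (ind ∘ S)                            ∎
      where open ≡-Reasoning

    twiceEcount-K⁺ : twiceEcount K⁺ ≡ twiceEcount K
    twiceEcount-K⁺ = begin
      sumFin (n G) row                                              ≡⟨ sumFin-skip a row ⟩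
      row a + sumFin (pred (n G)) (row ∘ skip a)                   ≡⟨ cong₂ _+_ (sumFin-zero _ (cong ind ∘ F⁺-self))
                                                                         (sumFin-cong _ row-skip) ⟩
      sumFin (pred (n G)) (λ i → sumFin (pred (n G)) (ind ∘ F i))   ∎
      where
      open ≡-Reasoning
      row : Fin (n G) → ℕ
      row u = sumFin (n G) (ind ∘ F⁺ u)
      row-skip : ∀ i → row (skip a i) ≡ sumFin (pred (n G)) (ind ∘ F i)
      row-skip i = trans (sumFin-skip a (ind ∘ F⁺ (skip a i)))
        (cong₂ _+_ (cong ind (F⁺-self′ (skip a i))) (sumFin-cong _ (cong ind ∘ F⁺-skip i)))

  mad-∖ : MadLessFiveHalves G → MadLessFiveHalves (G ∖ a)
  mad-∖ mad K 0<|K| =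
    subst₂ (λ e v → 2 * e < 5 * v) twiceEcount-K⁺ vcount-K⁺
      (mad K⁺ (subst (0 <_) (sym vcount-K⁺) 0<|K|))
    where open Pushforward K

  girth-∖ : ∀ {g} → GirthAtLeast G g → GirthAtLeast (G ∖ a) g
  girth-∖ girth l l<g = girth l l<g ∘ cycle-skip l
    where
    cycle-skip : ∀ l → Cycle (G ∖ a) l → Cycle G l
    cycle-skip (suc l) (2≤l , f , f-inj , consecutive , closing) =
      2≤l , skip a ∘ f , f-inj ∘ skip-injective a , consecutive , closing

  maxDegree-∖ : ∀ {d} → MaxDegreeIs G d → (∀ v → deg G v ≡ d → a ≢ v × ¬ Adj G a v) →
                MaxDegreeIs (G ∖ a) d
  maxDegree-∖ {d} (deg≤d , v , v-d) d-vertex-away =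
    (λ i → ≤-trans (m≤n+m _ _) (subst (_≤ d) (deg-skip i) (deg≤d (skip a i)))) ,
    witness (skipView a v) v-d (d-vertex-away v v-d)
    where
    witness : ∀ {v} → SkipView a v → deg G v ≡ d → a ≢ v × ¬ Adj G a v → ∃[ i ] deg (G ∖ a) i ≡ d
    witness self        _   (a≢a , _)   = ⊥-elim (a≢a refl)
    witness (skipped i) v-d (_ , ¬a~v) = i , (begin
      deg (G ∖ a) i                            ≡⟨ cong (λ e → ind e + deg (G ∖ a) i) (sym v≁a) ⟩
      ind (adj G (skip a i) a) + deg (G ∖ a) i ≡⟨ sym (deg-skip i) ⟩
      deg G (skip a i)                         ≡⟨ v-d ⟩
      d                                        ∎)
      where
      open ≡-Reasoning
      v≁a : adj G (skip a i) a ≡ false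
      v≁a = ¬-not (¬a~v ∘ Adj-sym G)

  Dist≤2-skip : ∀ {i j} → Dist≤2 G (skip a i) (skip a j) →
                Dist≤2 (G ∖ a) i j ⊎ (Adj G a (skip a i) × Adj G a (skip a j))
  Dist≤2-skip (inj₁ ij) = inj₁ (inj₁ ij)
  Dist≤2-skip (inj₂ (w , iw , wj)) with skipView a w
  ... | self      = inj₂ (Adj-sym G iw , wj)
  ... | skipped l = inj₁ (inj₂ (l , iw , wj))

  insert-proper : ∀ {c} → ProperFor (Dist≤2 (G ∖ a)) c → ∀ d {u v} →
                  a ≢ u → a ≢ v → u ≢ v → Dist≤2 G u v →
                  insert a d c u ≢ insert a d c v ⊎ (Adj G a u × Adj G a v)
  insert-proper {c} c-proper d {u} {v} a≢u a≢v u≢v uv with skipView a u | skipView a v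
  ... | self      | _         = ⊥-elim (a≢u refl)
  ... | skipped _ | self      = ⊥-elim (a≢v refl)
  ... | skipped i | skipped j with Dist≤2-skip uv
  ...   | inj₂ common = inj₂ common
  ...   | inj₁ ij     = inj₁ (subst₂ _≢_ (sym (insert-skip a d c i)) (sym (insert-skip a d c j))
                                 (c-proper i j (u≢v ∘ cong (skip a)) ij))

module TwoPathFromThreeVertex
  (G : Graph) (hyp : Hyp G) {x a b y : Fin (n G)}
  (x-3 : deg G x ≡ 3) (y-3⁺ : 3 ≤ deg G y) (a-2 : deg G a ≡ 2) (b-2 : deg G b ≡ 2)
  (x~a : Adj G x a) (a~b : Adj G a b) (b~y : Adj G b y) where

  open Deletion G a

  a≢x : a ≢ x
  a≢x = Adj⇒≢ G (Adj-sym G x~a)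

  a≢b : a ≢ b
  a≢b = Adj⇒≢ G a~b

  b≢x : b ≢ x
  b≢x = 2-vertex≢3⁺-vertex G b-2 (≤-reflexive (sym x-3))

  a≢y : a ≢ y
  a≢y = 2-vertex≢3⁺-vertex G a-2 y-3⁺

  a-neighbours : ∀ {w} → Adj G a w → w ≡ x ⊎ w ≡ b
  a-neighbours = degree-two-neighbours G a-2 (Adj-sym G x~a) a~b (b≢x ∘ sym)

  b-neighbours : ∀ {w} → Adj G b w → w ≡ a ⊎ w ≡ y
  b-neighbours = degree-two-neighbours G b-2 (Adj-sym G a~b) b~y a≢y

  hyp-∖ : Hyp (G ∖ a)
  hyp-∖ = let mad , girth , maxDegree = hyp in
    mad-∖ mad , girth-∖ girth , maxDegree-∖ maxDegree 4-vertex-away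
    where
    4-vertex-away : ∀ v → deg G v ≡ 4 → a ≢ v × ¬ Adj G a v
    4-vertex-away v v-4 = (λ { refl → 2≢4 (trans (sym a-2) v-4) }) , not-neighbour
      where
      2≢4 : 2 ≢ 4
      2≢4 ()
      not-neighbour : ¬ Adj G a v
      not-neighbour a~v with a-neighbours a~v
      ... | inj₁ refl with () ← trans (sym x-3) v-4
      ... | inj₂ refl with () ← trans (sym b-2) v-4

  D : Fin (n G) → Fin (n G) → Set
  D = Dist≤2 G

  -- The colour of a is provisional: it duplicates that of x, so that x's colour is
  -- accounted for among the colours of N(x) ∋ a when a is finally coloured.
  Precolouring : (Fin (n G) → List ℕ) → (Fin (n G) → ℕ) → Set
  Precolouring L c = c a ≡ c x × (∀ v → a ≢ v → c v ∈ L v) × ProperFor (Away a D) c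

  module _ (L : Fin (n G) → List ℕ) (L-ok : ∀ v → Unique (L v) × 6 ≤ length (L v)) where

    shorter-than-list : ∀ {F : List ℕ} p → length F ≤ 5 → length F < length (L p)
    shorter-than-list p |F|≤5 = ≤-trans (s≤s |F|≤5) (proj₂ (L-ok p))

    colour-a : ∀ {c} → Precolouring L c → ∃[ c ] Is2DistListColoring G L c
    colour-a {c} (a-copies , c-∈ , c-proper)
      with recolour-from-list (Dist≤2-sym G) c a (proj₁ (L-ok a)) (shorter-than-list {F} a |F|≤5) forced c-proper
      where
      F : List ℕ
      F = c b ∷ c y ∷ map c (neighbours G x)
      |F|≤5 : length F ≤ 5
      |F|≤5 = ≤-reflexive (cong (2 +_) (trans (length-colours G c x) x-3))
      forced : ∀ v → a ≢ v → D a v → c v ∈ F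
      forced v a≢v (inj₁ a~v) with a-neighbours a~v
      ... | inj₁ refl = there (there (subst (_∈ map c (neighbours G x)) a-copies
                                           (∈-map⁺ c (∈-neighbours G x~a))))
      ... | inj₂ refl = here refl
      forced v a≢v (inj₂ (w , a~w , w~v)) with a-neighbours a~w
      ... | inj₁ refl = there (there (∈-map⁺ c (∈-neighbours G w~v)))
      ... | inj₂ refl with b-neighbours w~v
      ...   | inj₁ refl = ⊥-elim (a≢v refl)
      ...   | inj₂ refl = there (here refl)
    ... | z , z∈La , proper = recolour c a z , (λ v → recolour-∈ {L = L} z∈La (c-∈ v)) , proper

    module _ (χ : Chi2lAtMost (G ∖ a) 6) where

      cH : Fin (n (G ∖ a)) → ℕ
      cH = proj₁ (χ (L ∘ skip a , L-ok ∘ skip a))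

      c₀ : Fin (n G) → ℕ
      c₀ = insert a (cH (unskip a≢x)) cH

      c₀-skip : ∀ i → c₀ (skip a i) ≡ cH i
      c₀-skip = insert-skip a _ cH

      c₀-a : c₀ a ≡ c₀ x
      c₀-a = begin
        c₀ a                       ≡⟨ insert-self a _ cH ⟩
        cH (unskip a≢x)            ≡⟨ sym (c₀-skip (unskip a≢x)) ⟩
        c₀ (skip a (unskip a≢x))   ≡⟨ cong c₀ (skip-unskip a≢x) ⟩
        c₀ x                       ∎
        where open ≡-Reasoning

      c₀-∈ : ∀ v → a ≢ v → c₀ v ∈ L v
      c₀-∈ v a≢v with skipView a v
      ... | self      = ⊥-elim (a≢v refl)
      ... | skipped i = subst (_∈ L (skip a i)) (sym (c₀-skip i))
                          (proj₁ (proj₂ (χ (L ∘ skip a , L-ok ∘ skip a))) i)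

      c₀-proper : ∀ {u v} → a ≢ u → a ≢ v → u ≢ v → D u v →
                  c₀ u ≢ c₀ v ⊎ (Adj G a u × Adj G a v)
      c₀-proper = insert-proper (proj₂ (proj₂ (χ (L ∘ skip a , L-ok ∘ skip a)))) _

      c₀-precolouring : c₀ b ≢ c₀ x → Precolouring L c₀
      c₀-precolouring b≁x = c₀-a , c₀-∈ , proper
        where
        proper : ProperFor (Away a D) c₀
        proper u v u≢v (a≢u , a≢v , uv) with c₀-proper a≢u a≢v u≢v uv
        ... | inj₁ cu≢cv = cu≢cv
        ... | inj₂ (a~u , a~v) with a-neighbours a~u | a-neighbours a~v
        ...   | inj₁ refl | inj₁ refl = ⊥-elim (u≢v refl)
        ...   | inj₁ refl | inj₂ refl = b≁x ∘ sym
        ...   | inj₂ refl | inj₁ refl = b≁x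
        ...   | inj₂ refl | inj₂ refl = ⊥-elim (u≢v refl)

      -- The clashing colour c₀ x = c₀ b is already among the colours of N(y) ∋ b, so
      -- avoiding it costs nothing.
      recolour-b : c₀ b ≡ c₀ x → ∃[ c ] Precolouring L c
      recolour-b b≈x
        with recolour-from-list (Away-sym (Dist≤2-sym G) a) c₀ b (proj₁ (L-ok b))
               (shorter-than-list {F} b |F|≤5) forced proper
        where
        F : List ℕ
        F = c₀ y ∷ map c₀ (neighbours G y)
        |F|≤5 : length F ≤ 5
        |F|≤5 = s≤s (subst (_≤ 4) (sym (length-colours G c₀ y)) (proj₁ (proj₂ (proj₂ hyp)) y))
        forced : ∀ v → b ≢ v → Away a D b v → c₀ v ∈ F
        forced v b≢v (_ , a≢v , inj₁ b~v) with b-neighbours b~v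
        ... | inj₁ refl = ⊥-elim (a≢v refl)
        ... | inj₂ refl = here refl
        forced v b≢v (_ , a≢v , inj₂ (w , b~w , w~v)) with b-neighbours b~w
        ... | inj₂ refl = there (∈-map⁺ c₀ (∈-neighbours G w~v))
        ... | inj₁ refl with a-neighbours w~v
        ...   | inj₁ refl = there (subst (_∈ map c₀ (neighbours G y)) b≈x
                                     (∈-map⁺ c₀ (∈-neighbours G (Adj-sym G b~y))))
        ...   | inj₂ refl = ⊥-elim (b≢v refl)
        proper : ProperFor (Away b (Away a D)) c₀
        proper u v u≢v (b≢u , b≢v , a≢u , a≢v , uv) with c₀-proper a≢u a≢v u≢v uv
        ... | inj₁ cu≢cv = cu≢cv
        ... | inj₂ (a~u , a~v) with a-neighbours a~u | a-neighbours a~v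
        ...   | inj₁ refl | inj₁ refl = ⊥-elim (u≢v refl)
        ...   | _         | inj₂ refl = ⊥-elim (b≢v refl)
        ...   | inj₂ refl | _         = ⊥-elim (b≢u refl)
      ... | z , z∈Lb , proper′ =
        recolour c₀ b z , a-copies , (λ v a≢v → recolour-∈ {L = L} z∈Lb (λ _ → c₀-∈ v a≢v)) ,
        proper′
        where
        a-copies : recolour c₀ b z a ≡ recolour c₀ b z x
        a-copies = begin
          recolour c₀ b z a ≡⟨ recolour-other c₀ z (a≢b ∘ sym) ⟩
          c₀ a              ≡⟨ c₀-a ⟩
          c₀ x              ≡⟨ sym (recolour-other c₀ z b≢x) ⟩
          recolour c₀ b z x ∎
          where open ≡-Reasoning

      precolouring : ∃[ c ] Precolouring L c
      precolouring with c₀ b ℕ.≟ c₀ x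
      ... | no b≁x  = c₀ , c₀-precolouring b≁x
      ... | yes b≈x = recolour-b b≈x

  extend : Chi2lAtMost (G ∖ a) 6 → Chi2lAtMost G 6
  extend χ (L , L-ok) = colour-a L L-ok (proj₂ (precolouring L L-ok χ))

TwoPath-reverse : ∀ {G x a b y} → TwoPath G x a b y → TwoPath G y b a x
TwoPath-reverse {G} (x-3⁺ , y-3⁺ , a-2 , b-2 , x~a , a~b , b~y , x≢y) =
  y-3⁺ , x-3⁺ , b-2 , a-2 , Adj-sym G b~y , Adj-sym G a~b , Adj-sym G x~a , x≢y ∘ sym

first-end-is-4-vertex : ∀ {G} → MinimalCounterexample G →
                        ∀ {x a b y} → TwoPath G x a b y → deg G x ≡ 4
first-end-is-4-vertex {G} (hyp , ¬χ , minimal) {x} {a}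
                      (x-3⁺ , y-3⁺ , a-2 , b-2 , x~a , a~b , b~y , _) with deg G x ℕ.≟ 3
... | yes x-3 = ⊥-elim (¬χ (extend (minimal (G ∖ a) (pred<n a) hyp-∖)))
  where open TwoPathFromThreeVertex G hyp x-3 y-3⁺ a-2 b-2 x~a a~b b~y
... | no x≢3  = ≤-antisym (proj₁ (proj₂ (proj₂ hyp)) x) (≤∧≢⇒< x-3⁺ (x≢3 ∘ sym))

lemma13 : (G : Graph) → MinimalCounterexample G →
    (x a b y : Fin (n G)) → TwoPath G x a b y → deg G x ≡ 4 × deg G y ≡ 4
lemma13 G mc x a b y P =
  first-end-is-4-vertex mc P , first-end-is-4-vertex mc (TwoPath-reverse {G} {x} {a} {b} {y} P)
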